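{- Let $G$ be a graph with $n$ vertices and $Tr(G)=k$. Then $G$ is $Tr_k^{e}$-critical if and only if $G=H\cup\overline{K}_{n-n_H}$ (disjoint union), where $H$ is a $Tr_k^{(v,e)}$-critical graph having $n_H$ vertices.
   Context: All graphs are finite and simple; $\overline{K}_m$ is the edgeless graph on $m$ vertices. For disjoint $A,B\subseteq V$, $A$ dominates $B$ if every vertex of $B$ is adjacent to at least one vertex of $A$. A transitive $k$-partition of $G=(V,E)$ is a partition $\{V_1,\dots,V_k\}$ of $V$ into $k$ nonempty parts such that $V_i$ dominates $V_j$ for all $1\le i<j\le k$; the transitivity $Tr(G)$ is the maximum such $k$. $G$ is transitively edge critical if deleting any edge yields a graph of transitivity less than $Tr(G)$; with $Tr(G)=k$ it is called $Tr_k^{e}$-critical. $G$ is transitively vertex-edge critical if deleting any element of $V\cup E$ (deleting a vertex removes it with its incident edges) yields a graph of transitivity less than $Tr(G)$; with $Tr(G)=k$ it is called $Tr_k^{(v,e)}$-critical. -}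

module Defs where

open import Data.Nat using (ℕ; suc; _+_; _∸_; _<_; _≤_)
open import Data.Fin using (Fin; splitAt; punchIn)
open import Data.Sum using (_⊎_; inj₁; inj₂)
open import Data.Product using (Σ; ∃; _×_; _,_; proj₁; proj₂)
open import Data.Empty using (⊥)
open import Relation.Nullary using (¬_)
open import Relation.Binary.PropositionalEquality using (_≡_)
open import Function.Bundles using (_↔_; Inverse)

record Graph (n : ℕ) : Set₁ where
  field
    Adj    : Fin n → Fin n → Set
    sym    : ∀ {x y} → Adj x y → Adj y x
    irrefl : ∀ {x} → ¬ Adj x x
open Graph public

-- A transitive k-partition: an ordered partition (V_1,…,V_k) of the vertex set
-- into k nonempty parts, encoded as a surjective labelling p : Fin n → Fin k
-- (V_i = p⁻¹(i)), such that V_i dominates V_j whenever i < j.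
record TransitivePartition {n : ℕ} (G : Graph n) (k : ℕ) : Set where
  field
    part      : Fin n → Fin k
    nonempty  : ∀ (i : Fin k) → ∃ λ v → part v ≡ i
    dominates : ∀ (i j : Fin k) → Data.Fin._<_ i j →
                ∀ v → part v ≡ j → ∃ λ u → part u ≡ i × Adj G u v

IsTr : ∀ {n} → Graph n → ℕ → Set
IsTr G k = TransitivePartition G k × (∀ m → TransitivePartition G m → m ≤ k)

TrLess : ∀ {n} → Graph n → ℕ → Set
TrLess G k = ∀ k' → IsTr G k' → k' < k

deleteEdge : ∀ {n} → Graph n → Fin n → Fin n → Graph n
deleteEdge G u v = record
  { Adj    = λ x y → Adj G x y × ¬ (x ≡ u × y ≡ v) × ¬ (x ≡ v × y ≡ u)
  ; sym    = λ { (a , p , q) → sym G a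
                 , (λ { (e1 , e2) → q (e2 , e1) })
                 , (λ { (e1 , e2) → p (e2 , e1) }) }
  ; irrefl = λ { (a , _ , _) → irrefl G a }
  }

deleteVertex : ∀ {m} → Graph (suc m) → Fin (suc m) → Graph m
deleteVertex G w = record
  { Adj    = λ x y → Adj G (punchIn w x) (punchIn w y)
  ; sym    = sym G
  ; irrefl = irrefl G
  }

EdgeCritical : ∀ {n} → Graph n → ℕ → Set
EdgeCritical G k =
  IsTr G k × (∀ u v → Adj G u v → TrLess (deleteEdge G u v) k)

VertexDeletionsLower : ∀ {n} → Graph n → ℕ → Set
VertexDeletionsLower {ℕ.zero}  G k = Data.Unit.⊤
  where import Data.Unit
VertexDeletionsLower {suc m} G k = ∀ w → TrLess (deleteVertex G w) k

VertexEdgeCritical : ∀ {n} → Graph n → ℕ → Set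
VertexEdgeCritical G k =
  IsTr G k × VertexDeletionsLower G k × (∀ u v → Adj G u v → TrLess (deleteEdge G u v) k)

edgeless : (m : ℕ) → Graph m
edgeless m = record { Adj = λ _ _ → ⊥ ; sym = λ () ; irrefl = λ () }

UAdj : ∀ {a b} → Graph a → Graph b → (Fin a ⊎ Fin b) → (Fin a ⊎ Fin b) → Set
UAdj H K (inj₁ x) (inj₁ y) = Adj H x y
UAdj H K (inj₂ x) (inj₂ y) = Adj K x y
UAdj H K (inj₁ x) (inj₂ y) = ⊥
UAdj H K (inj₂ x) (inj₁ y) = ⊥

UAdj-sym : ∀ {a b} (H : Graph a) (K : Graph b) x y → UAdj H K x y → UAdj H K y x
UAdj-sym H K (inj₁ x) (inj₁ y) e = sym H e
UAdj-sym H K (inj₂ x) (inj₂ y) e = sym K e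

UAdj-irr : ∀ {a b} (H : Graph a) (K : Graph b) x → ¬ UAdj H K x x
UAdj-irr H K (inj₁ x) e = irrefl H e
UAdj-irr H K (inj₂ x) e = irrefl K e

_∪G_ : ∀ {a b} → Graph a → Graph b → Graph (a + b)
_∪G_ {a} H K = record
  { Adj    = λ x y → UAdj H K (splitAt a x) (splitAt a y)
  ; sym    = λ {x} {y} → UAdj-sym H K (splitAt a x) (splitAt a y)
  ; irrefl = λ {x} → UAdj-irr H K (splitAt a x)
  }

record _≅G_ {n m : ℕ} (G : Graph n) (G' : Graph m) : Set where
  field
    bij      : Fin n ↔ Fin m
    preserve : ∀ x y → (Adj G x y → Adj G' (Inverse.to bij x) (Inverse.to bij y))
                     × (Adj G' (Inverse.to bij x) (Inverse.to bij y) → Adj G x y)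

-- Fix a transitive k-partition V_1, …, V_k of an edge-critical G with k ≥ 2. It only uses edges
-- inside its core: the vertices outside V_1 and one chosen V_1-dominator for each of them. An edge
-- at a vertex outside the core could therefore be deleted without losing the partition, so by
-- criticality such vertices are isolated, and the core H carries every edge of G. Partitions with
-- at least two parts restrict from G to H, and partitions of a subgraph extend to G by putting the
-- new vertices into V_1. Hence Tr(H) = k, deleting an edge of H lowers Tr as it does in G, and
-- deleting a core vertex w lowers Tr because H − w embeds into G − wz for a neighbour z of w.
-- Conversely, isolated vertices do not affect partitions with two or more parts, so the
-- edge-criticality of H passes to G. For k ≤ 1 the graph is edgeless and H is K_1 or empty.
module Submission where

open import Defs
open import Data.Nat using (ℕ; zero; suc; _+_; _∸_; _≤_; _<_; z≤n; s≤s; _<?_)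
open import Data.Nat.Properties using (1+n≰n; +-comm; ≤-trans; ≤-pred; ≤∧≢⇒<; ≤-<-trans; <-irrefl; n≮0; m≤m+n; m+n∸m≡n)
open import Data.Fin as F using (Fin; zero; suc; splitAt; join; punchIn; _↑ˡ_)
open import Data.Fin.Properties as FP using (¬Fin0; +↔⊎; splitAt-join; splitAt-↑ˡ; splitAt⁻¹-↑ˡ; punchInᵢ≢i; injective⇒≤; any?; ↑ˡ-injective)
open import Data.Sum using (_⊎_; inj₁; inj₂)
open import Data.Product using (Σ; ∃; _×_; _,_; proj₁; proj₂)
open import Data.Unit using (tt)
open import Data.Bool using (if_then_else_)
open import Function using (_∘_)
open import Function.Bundles using (_⇔_; _↔_; Inverse; mk⇔)
open import Function.Definitions using (Injective)
open import Function.Properties.Inverse using (↔-trans; ↔-sym; ↔-refl)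
open import Function.Related.TypeIsomorphisms using (⊎-assoc; ⊎-comm)
open import Data.Sum.Function.Propositional using (_⊎-↔_)
open import Level using (0ℓ)
open import Relation.Nullary using (¬_; yes; no; does; contradiction)
open import Relation.Nullary.Decidable using (¬¬-excluded-middle; decidable-stable; dec-true; dec-false; _⊎-dec_; _×-dec_)
open import Relation.Unary using (Pred; Decidable)
open import Relation.Binary.PropositionalEquality
  using (_≡_; _≢_; refl; cong; subst; subst₂; trans) renaming (sym to ≡-sym)

HasMaximum : (ℕ → Set) → Set
HasMaximum P = ∃ λ k → P k × (∀ j → P j → j ≤ k)

¬¬-hasMaximum : (P : ℕ → Set) (B : ℕ) → (∀ j → P j → j ≤ B) → ∀ {m} → P m → ¬ ¬ HasMaximum P
¬¬-hasMaximum P zero    bounded {m} Pm ¬max = ¬max (m , Pm , λ j Pj → ≤-trans (bounded j Pj) z≤n)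
¬¬-hasMaximum P (suc B) bounded Pm ¬max = ¬¬-excluded-middle λ where
  (yes PsB) → ¬max (suc B , PsB , bounded)
  (no ¬PsB) → ¬¬-hasMaximum P B (λ j Pj → ≤-pred (≤∧≢⇒< (bounded j Pj) λ { refl → ¬PsB Pj })) Pm ¬max

partition-size≤ : ∀ {n m} {G : Graph n} → TransitivePartition G m → m ≤ n
partition-size≤ P = injective⇒≤ {f = representative} λ {i} {j} eq →
  trans (≡-sym (proj₂ (nonempty i))) (trans (cong part eq) (proj₂ (nonempty j)))
  where
  open TransitivePartition P
  representative : Fin _ → Fin _
  representative i = proj₁ (nonempty i)

-- TrLess G k only constrains a maximum partition size; as partitions have at most n parts,
-- a maximum exists classically, which is enough for the decidable goal m < k.
TrLess⇒partition< : ∀ {n k m} {G : Graph n} → TrLess G k → TransitivePartition G m → m < k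
TrLess⇒partition< {G = G} Tr<k P = decidable-stable (_ <? _) λ m≮k →
  ¬¬-hasMaximum (TransitivePartition G) _ (λ _ → partition-size≤) P
    λ (k′ , isTr) → m≮k (≤-<-trans (proj₂ isTr _ P) (Tr<k k′ isTr))

twoPartition : ∀ {n} (G : Graph n) {u v} → Adj G u v → TransitivePartition G 2
twoPartition {n} G {u} {v} uv = record { part = part ; nonempty = nonempty ; dominates = dominates }
  where
  part : Fin n → Fin 2
  part w = if does (w FP.≟ v) then suc zero else zero
  part≡1 : ∀ w → part w ≡ suc zero → w ≡ v
  part≡1 w with w FP.≟ v
  ... | yes w≡v = λ _ → w≡v
  ... | no _    = λ ()
  u∈0 : part u ≡ zero
  u∈0 = cong (if_then suc zero else zero) (dec-false (u FP.≟ v) λ { refl → irrefl G uv })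
  nonempty : ∀ i → ∃ λ w → part w ≡ i
  nonempty zero       = u , u∈0
  nonempty (suc zero) = v , cong (if_then suc zero else zero) (dec-true (v FP.≟ v) refl)
  dominates : ∀ i j → i F.< j → ∀ w → part w ≡ j → ∃ λ x → part x ≡ i × Adj G x w
  dominates zero (suc zero) _ w w∈1 with refl ← part≡1 w w∈1 = u , u∈0 , uv
  dominates zero       zero       ()
  dominates (suc zero) (suc zero) (s≤s ())

edge⇒2≤Tr : ∀ {n k} {G : Graph n} → IsTr G k → ∀ {u v} → Adj G u v → 2 ≤ k
edge⇒2≤Tr {G = G} (_ , maximal) uv = maximal 2 (twoPartition G uv)

record _⊆G_ {a b} (H : Graph a) (G : Graph b) : Set where
  field
    embed     : Fin a → Fin b
    injective : Injective _≡_ _≡_ embed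
    preserves : ∀ {x y} → Adj H x y → Adj G (embed x) (embed y)

⊆G-trans : ∀ {a b c} {F : Graph a} {H : Graph b} {G : Graph c} → F ⊆G H → H ⊆G G → F ⊆G G
⊆G-trans F⊆H H⊆G = record
  { embed     = HG.embed ∘ FH.embed
  ; injective = FH.injective ∘ HG.injective
  ; preserves = HG.preserves ∘ FH.preserves
  }
  where
  module FH = _⊆G_ F⊆H
  module HG = _⊆G_ H⊆G

-- Vertices outside the image of H go to the first part, which never has to be dominated.
extendPartition : ∀ {a b m} {H : Graph a} {G : Graph b} →
  H ⊆G G → TransitivePartition H (suc m) → TransitivePartition G (suc m)
extendPartition {b = b} {m} {G = G} H⊆G P = record
  { part = part′ ; nonempty = nonempty′ ; dominates = dominates′ }
  where
  open _⊆G_ H⊆G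
  open TransitivePartition P
  part′ : Fin b → Fin (suc m)
  part′ v with any? (λ x → embed x FP.≟ v)
  ... | yes (x , _) = part x
  ... | no _        = zero
  part′-embed : ∀ x → part′ (embed x) ≡ part x
  part′-embed x with any? (λ y → embed y FP.≟ embed x)
  ... | yes (y , ey≡ex) = cong part (injective ey≡ex)
  ... | no ∄            = contradiction (x , refl) ∄
  image-or-first : ∀ v → (∃ λ x → embed x ≡ v) ⊎ part′ v ≡ zero
  image-or-first v with any? (λ x → embed x FP.≟ v)
  ... | yes x∈image = inj₁ x∈image
  ... | no _        = inj₂ refl
  nonempty′ : ∀ i → ∃ λ v → part′ v ≡ i
  nonempty′ i = embed (proj₁ (nonempty i)) , trans (part′-embed _) (proj₂ (nonempty i))
  dominates′ : ∀ i j → i F.< j → ∀ v → part′ v ≡ j → ∃ λ u → part′ u ≡ i × Adj G u v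
  dominates′ i j i<j v v∈j with image-or-first v
  ... | inj₂ v∈0 = contradiction (subst (i F.<_) (trans (≡-sym v∈j) v∈0) i<j) n≮0
  ... | inj₁ (x , refl) with dominates i j i<j x (trans (≡-sym (part′-embed x)) v∈j)
  ... | y , y∈i , yx = embed y , trans (part′-embed y) y∈i , preserves yx

⊆G-TrLess : ∀ {a b k} {H : Graph a} {G : Graph b} → H ⊆G G → TrLess G (suc k) → TrLess H (suc k)
⊆G-TrLess H⊆G Tr<k zero    _       = s≤s z≤n
⊆G-TrLess H⊆G Tr<k (suc m) (P , _) = TrLess⇒partition< Tr<k (extendPartition H⊆G P)

⊆G-partition≤ : ∀ {a b k m} {H : Graph a} {G : Graph b} →
  H ⊆G G → IsTr G k → TransitivePartition H m → m ≤ k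
⊆G-partition≤ {m = zero}  H⊆G _              _ = z≤n
⊆G-partition≤ {m = suc m} H⊆G (_ , maximal) P = maximal (suc m) (extendPartition H⊆G P)

deleteEdge-⊆G : ∀ {a b} {H : Graph a} {G : Graph b} (H⊆G : H ⊆G G) (let open _⊆G_ H⊆G) x y →
  deleteEdge H x y ⊆G deleteEdge G (embed x) (embed y)
deleteEdge-⊆G H⊆G x y = record
  { embed     = embed
  ; injective = injective
  ; preserves = λ (uv , ≢xy , ≢yx) →
      preserves uv , (λ (p , q) → ≢xy (injective p , injective q))
                   , (λ (p , q) → ≢yx (injective p , injective q))
  }
  where open _⊆G_ H⊆G

deleteVertex-⊆G : ∀ {a b} {H : Graph (suc a)} {G : Graph b} (H⊆G : H ⊆G G) (let open _⊆G_ H⊆G) w z →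
  deleteVertex H w ⊆G deleteEdge G (embed w) z
deleteVertex-⊆G H⊆G w z = record
  { embed     = embed ∘ punchIn w
  ; injective = FP.punchIn-injective w _ _ ∘ injective
  ; preserves = λ {x} {y} xy →
      preserves xy , (λ (p , _) → punchInᵢ≢i w x (injective p))
                   , (λ (_ , q) → punchInᵢ≢i w y (injective q))
  }
  where open _⊆G_ H⊆G

-- Up to isolated vertices, G is a subgraph of an image of H: every edge of G lies over an edge of H.
record EdgeCover {a b} (H : Graph a) (G : Graph b) : Set where
  field
    embed    : Fin a → Fin b
    reflects : ∀ {x y} → Adj G (embed x) (embed y) → Adj H x y
    covers   : ∀ {u v} → Adj G u v → ∃ λ x → embed x ≡ u

EdgeCover-trans : ∀ {a b c} {F : Graph a} {H : Graph b} {G : Graph c} →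
  EdgeCover F H → EdgeCover H G → EdgeCover F G
EdgeCover-trans {G = G} F◁H H◁G = record
  { embed    = HG.embed ∘ FH.embed
  ; reflects = FH.reflects ∘ HG.reflects
  ; covers   = covers
  }
  where
  module FH = EdgeCover F◁H
  module HG = EdgeCover H◁G
  covers : ∀ {u v} → Adj G u v → ∃ λ x → HG.embed (FH.embed x) ≡ u
  covers uv with HG.covers uv | HG.covers (sym G uv)
  ... | _ , refl | _ , refl with FH.covers (HG.reflects uv)
  ... | x , refl = x , refl

-- Every vertex of a part V_j with j > 1 has an edge, so it lies over H; and V_1
-- meets H because it dominates V_2.
restrictPartition : ∀ {a b m} {H : Graph a} {G : Graph b} →
  EdgeCover H G → TransitivePartition G (suc (suc m)) → TransitivePartition H (suc (suc m))
restrictPartition {H = H} {G} H◁G P = record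
  { part = part ∘ embed ; nonempty = nonempty′ ; dominates = dominates′ }
  where
  open EdgeCover H◁G
  open TransitivePartition P
  nonempty′ : ∀ i → ∃ λ x → part (embed x) ≡ i
  nonempty′ zero with nonempty (suc zero)
  ... | v , v∈1 with dominates zero (suc zero) (s≤s z≤n) v v∈1
  ... | u , u∈0 , uv with covers uv
  ... | x , refl = x , u∈0
  nonempty′ (suc i) with nonempty (suc i)
  ... | v , v∈i with dominates zero (suc i) (s≤s z≤n) v v∈i
  ... | u , _ , uv with covers (sym G uv)
  ... | x , refl = x , v∈i
  dominates′ : ∀ i j → i F.< j → ∀ x → part (embed x) ≡ j → ∃ λ y → part (embed y) ≡ i × Adj H y x
  dominates′ i j i<j x x∈j with dominates i j i<j (embed x) x∈j
  ... | u , u∈i , ux with covers ux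
  ... | y , refl = y , u∈i , reflects ux

EdgeCover-TrLess : ∀ {a b k} {H : Graph a} {G : Graph b} → EdgeCover H G → 2 ≤ k → TrLess H k → TrLess G k
EdgeCover-TrLess H◁G 2≤k Tr<k zero          _       = ≤-trans (s≤s z≤n) 2≤k
EdgeCover-TrLess H◁G 2≤k Tr<k (suc zero)    _       = 2≤k
EdgeCover-TrLess H◁G 2≤k Tr<k (suc (suc m)) (P , _) = TrLess⇒partition< Tr<k (restrictPartition H◁G P)

deleteEdge-EdgeCover : ∀ {a b} {H : Graph a} {G : Graph b} (H◁G : EdgeCover H G) (let open EdgeCover H◁G) x y →
  EdgeCover (deleteEdge H x y) (deleteEdge G (embed x) (embed y))
deleteEdge-EdgeCover H◁G x y = record
  { embed    = embed
  ; reflects = λ (uv , ≢xy , ≢yx) →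
      reflects uv , (λ (p , q) → ≢xy (cong embed p , cong embed q))
                  , (λ (p , q) → ≢yx (cong embed p , cong embed q))
  ; covers   = covers ∘ proj₁
  }
  where open EdgeCover H◁G

induced : ∀ {m n} → Graph n → (Fin m → Fin n) → Graph m
induced G e = record { Adj = λ x y → Adj G (e x) (e y) ; sym = sym G ; irrefl = irrefl G }

≅G-⊆G : ∀ {n m} {G : Graph n} {G′ : Graph m} → G ≅G G′ → G′ ⊆G G
≅G-⊆G {G′ = G′} G≅G′ = record
  { embed     = from
  ; injective = λ {x} {y} p → trans (≡-sym (strictlyInverseˡ x)) (trans (cong to p) (strictlyInverseˡ y))
  ; preserves = λ {x} {y} xy → proj₂ (preserve (from x) (from y))
                  (subst₂ (Adj G′) (≡-sym (strictlyInverseˡ x)) (≡-sym (strictlyInverseˡ y)) xy)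
  }
  where
  open _≅G_ G≅G′
  open Inverse bij

≅G-EdgeCover : ∀ {n m} {G : Graph n} {G′ : Graph m} → G ≅G G′ → EdgeCover G′ G
≅G-EdgeCover {G′ = G′} G≅G′ = record
  { embed    = from
  ; reflects = λ {x} {y} xy → subst₂ (Adj G′) (strictlyInverseˡ x) (strictlyInverseˡ y)
                                 (proj₁ (preserve (from x) (from y)) xy)
  ; covers   = λ {u} _ → to u , strictlyInverseʳ u
  }
  where
  open _≅G_ G≅G′
  open Inverse bij

∪G-⊆G : ∀ {a b} {H : Graph a} {K : Graph b} → H ⊆G (H ∪G K)
∪G-⊆G {a} {b} {H} {K} = record
  { embed     = _↑ˡ b
  ; injective = ↑ˡ-injective b _ _
  ; preserves = λ {x} {y} → subst₂ (UAdj H K) (≡-sym (splitAt-↑ˡ a x b)) (≡-sym (splitAt-↑ˡ a y b))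
  }

∪G-EdgeCover : ∀ {a b} {H : Graph a} → EdgeCover H (H ∪G edgeless b)
∪G-EdgeCover {a} {b} {H} = record
  { embed    = _↑ˡ b
  ; reflects = λ {x} {y} → subst₂ (UAdj H K) (splitAt-↑ˡ a x b) (splitAt-↑ˡ a y b)
  ; covers   = λ {u} {v} → covers u v
  }
  where
  K : Graph b
  K = edgeless b
  covers : ∀ u v → UAdj H K (splitAt a u) (splitAt a v) → ∃ λ x → x ↑ˡ b ≡ u
  covers u v uv with splitAt a u in eq | splitAt a v
  covers u v uv  | inj₁ x | inj₁ _ = x , splitAt⁻¹-↑ˡ eq
  covers u v ()  | inj₁ _ | inj₂ _
  covers u v ()  | inj₂ _ | inj₁ _
  covers u v ()  | inj₂ _ | inj₂ _

splitIsolated-≅G : ∀ {n m r} {G : Graph n} (s : Fin n ↔ (Fin m ⊎ Fin r)) (let open Inverse s) →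
  (∀ b z → ¬ Adj G (from (inj₂ b)) z) → G ≅G (induced G (from ∘ inj₁) ∪G edgeless r)
splitIsolated-≅G {m = m} {r} {G} s isolated = record
  { bij = ↔-trans s (↔-sym +↔⊎) ; preserve = λ x y → adj⇒ x y , adj⇐ x y }
  where
  open Inverse s
  H : Graph m
  H = induced G (from ∘ inj₁)
  K : Graph r
  K = edgeless r
  sum-adj⇒ : ∀ p q → Adj G (from p) (from q) → UAdj H K p q
  sum-adj⇒ (inj₁ _) (inj₁ _) pq = pq
  sum-adj⇒ (inj₁ _) (inj₂ b) pq = contradiction (sym G pq) (isolated b _)
  sum-adj⇒ (inj₂ a) _        pq = contradiction pq (isolated a _)
  sum-adj⇐ : ∀ p q → UAdj H K p q → Adj G (from p) (from q)
  sum-adj⇐ (inj₁ _) (inj₁ _) pq = pq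
  sum-adj⇐ (inj₁ _) (inj₂ _) ()
  sum-adj⇐ (inj₂ _) (inj₁ _) ()
  sum-adj⇐ (inj₂ _) (inj₂ _) ()
  splitAt-to : ∀ x → splitAt m (join m r (to x)) ≡ to x
  splitAt-to x = splitAt-join m r (to x)
  adj⇒ : ∀ x y → Adj G x y → UAdj H K (splitAt m (join m r (to x))) (splitAt m (join m r (to y)))
  adj⇒ x y xy = subst₂ (UAdj H K) (≡-sym (splitAt-to x)) (≡-sym (splitAt-to y))
    (sum-adj⇒ (to x) (to y) (subst₂ (Adj G) (≡-sym (strictlyInverseʳ x)) (≡-sym (strictlyInverseʳ y)) xy))
  adj⇐ : ∀ x y → UAdj H K (splitAt m (join m r (to x))) (splitAt m (join m r (to y))) → Adj G x y
  adj⇐ x y xy = subst₂ (Adj G) (strictlyInverseʳ x) (strictlyInverseʳ y)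
    (sum-adj⇐ (to x) (to y) (subst₂ (UAdj H K) (splitAt-to x) (splitAt-to y) xy))

edgeless-≅G : ∀ {n m} {G : Graph n} {G′ : Graph m} →
  (∀ x y → ¬ Adj G x y) → (∀ x y → ¬ Adj G′ x y) → Fin n ↔ Fin m → G ≅G G′
edgeless-≅G noEdge noEdge′ bij = record
  { bij = bij ; preserve = λ x y → (λ xy → contradiction xy (noEdge x y)) , (λ xy → contradiction xy (noEdge′ _ _)) }

∪G-edgeless-noEdge : ∀ {a b} x y → ¬ Adj (edgeless a ∪G edgeless b) x y
∪G-edgeless-noEdge {a} x y with splitAt a x | splitAt a y
... | inj₁ _ | inj₁ _ = λ ()
... | inj₁ _ | inj₂ _ = λ ()
... | inj₂ _ | inj₁ _ = λ ()
... | inj₂ _ | inj₂ _ = λ ()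

record Split {n} (P Q : Pred (Fin n) 0ℓ) : Set where
  field
    m r   : ℕ
    m+r≡n : m + r ≡ n
    bij   : Fin n ↔ (Fin m ⊎ Fin r)
    left  : ∀ a → P (Inverse.from bij (inj₁ a))
    right : ∀ b → Q (Inverse.from bij (inj₂ b))

swapSplit : ∀ {n} {P Q : Pred (Fin n) 0ℓ} → Split P Q → Split Q P
swapSplit s = record
  { m = r ; r = m ; m+r≡n = trans (+-comm r m) m+r≡n
  ; bij = ↔-trans bij (⊎-comm _ _) ; left = right ; right = left }
  where open Split s

consLeft : ∀ {n} {P Q : Pred (Fin (suc n)) 0ℓ} → P zero → Split (P ∘ suc) (Q ∘ suc) → Split P Q
consLeft {n} P0 s = record
  { m = suc m ; r = r ; m+r≡n = cong suc m+r≡n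
  ; bij = ↔-trans (+↔⊎ {1} {n}) (↔-trans (↔-refl ⊎-↔ bij)
            (↔-trans (↔-sym (⊎-assoc 0ℓ (Fin 1) (Fin m) (Fin r))) (↔-sym (+↔⊎ {1} {m}) ⊎-↔ ↔-refl)))
  ; left = λ { zero → P0 ; (suc a) → left a }
  ; right = right }
  where open Split s

split : ∀ {n} {P : Pred (Fin n) 0ℓ} → Decidable P → Split P (¬_ ∘ P)
split {zero} P? = record
  { m = 0 ; r = 0 ; m+r≡n = refl ; bij = +↔⊎ {0} {0} ; left = λ () ; right = λ () }
split {suc n} P? with P? zero
... | yes P0 = consLeft P0 (split (P? ∘ suc))
... | no ¬P0 = swapSplit (consLeft ¬P0 (swapSplit (split (P? ∘ suc))))

EdgeDeletionsLower : ∀ {n} → Graph n → ℕ → Set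
EdgeDeletionsLower G k = ∀ u v → Adj G u v → TrLess (deleteEdge G u v) k

module Core {n k} {G : Graph n} (P : TransitivePartition G (suc k)) where
  open TransitivePartition P

  V₁ : Fin (suc k)
  V₁ = zero

  Positive : Fin n → Set
  Positive v = V₁ F.< part v

  positive? : Decidable Positive
  positive? v = V₁ FP.<? part v

  dominator : Fin n → Fin n
  dominator v with positive? v
  ... | yes pos = proj₁ (dominates zero (part v) pos v refl)
  ... | no _    = v

  dominator-spec : ∀ {v} → Positive v → part (dominator v) ≡ zero × Adj G (dominator v) v
  dominator-spec {v} pos with positive? v
  ... | yes pos′ = proj₂ (dominates zero (part v) pos′ v refl)
  ... | no ¬pos  = contradiction pos ¬pos

  InCore : Fin n → Set
  InCore w = Positive w ⊎ ∃ λ v → Positive v × dominator v ≡ w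

  inCore? : Decidable InCore
  inCore? w = positive? w ⊎-dec any? (λ v → positive? v ×-dec (dominator v FP.≟ w))

  inCore-neighbour : ∀ {w} → InCore w → ∃ (Adj G w)
  inCore-neighbour (inj₁ pos)             = _ , sym G (proj₂ (dominator-spec pos))
  inCore-neighbour (inj₂ (v , pos , refl)) = v , proj₂ (dominator-spec pos)

  partition-deleteEdge : ∀ {w} → ¬ InCore w → ∀ z → TransitivePartition (deleteEdge G w z) (suc k)
  partition-deleteEdge {w} w∉core z = record { part = part ; nonempty = nonempty ; dominates = dominates′ }
    where
    positive-≢ : ∀ {v} → Positive v → v ≢ w
    positive-≢ pos refl = w∉core (inj₁ pos)
    dominator-≢ : ∀ {v} → Positive v → dominator v ≢ w
    dominator-≢ pos eq = w∉core (inj₂ (_ , pos , eq))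
    positive-of : ∀ {v i} → part v ≡ i → V₁ F.< i → Positive v
    positive-of v∈i = subst (V₁ F.<_) (≡-sym v∈i)
    dominates′ : ∀ i j → i F.< j → ∀ v → part v ≡ j → ∃ λ u → part u ≡ i × Adj (deleteEdge G w z) u v
    dominates′ zero j 0<j v v∈j =
      dominator v , proj₁ (dominator-spec pos) , proj₂ (dominator-spec pos)
        , (λ (eq , _) → dominator-≢ pos eq) , (λ (_ , eq) → positive-≢ pos eq)
      where
      pos : Positive v
      pos = positive-of v∈j 0<j
    dominates′ (suc i) j i<j v v∈j with dominates (suc i) j i<j v v∈j
    ... | u , u∈i , uv = u , u∈i , uv
        , (λ (eq , _) → positive-≢ (positive-of u∈i (s≤s z≤n)) eq)
        , (λ (_ , eq) → positive-≢ (positive-of v∈j (≤-<-trans z≤n i<j)) eq)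

  outsideCore-isolated : EdgeDeletionsLower G (suc k) → ∀ {w} → ¬ InCore w → ∀ z → ¬ Adj G w z
  outsideCore-isolated critical w∉core z wz =
    <-irrefl refl (TrLess⇒partition< (critical _ _ wz) (partition-deleteEdge w∉core z))

⊆G-edgeDeletionsLower : ∀ {a b k} {H : Graph a} {G : Graph b} →
  H ⊆G G → EdgeDeletionsLower G (suc k) → EdgeDeletionsLower H (suc k)
⊆G-edgeDeletionsLower H⊆G critical x y xy =
  ⊆G-TrLess (deleteEdge-⊆G H⊆G x y) (critical _ _ (_⊆G_.preserves H⊆G xy))

⊆G-vertexDeletionsLower : ∀ {a b k} {H : Graph a} {G : Graph b} →
  H ⊆G G → (∀ x → ∃ (Adj H x)) → EdgeDeletionsLower G (suc k) → VertexDeletionsLower H (suc k)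
⊆G-vertexDeletionsLower {zero}  _   _          _        = tt
⊆G-vertexDeletionsLower {suc a} {H = H} H⊆G noIsolated critical w =
  ⊆G-TrLess (deleteVertex-⊆G H⊆G w (embed y)) (critical _ _ (preserves wy))
  where
  open _⊆G_ H⊆G
  y : Fin (suc a)
  y = proj₁ (noIsolated w)
  wy : Adj H w y
  wy = proj₂ (noIsolated w)

EdgeCover-edgeDeletionsLower : ∀ {a b k} {H : Graph a} {G : Graph b} →
  EdgeCover H G → IsTr G k → EdgeDeletionsLower H k → EdgeDeletionsLower G k
EdgeCover-edgeDeletionsLower {G = G} H◁G trG critical u v uv
  with EdgeCover.covers H◁G uv | EdgeCover.covers H◁G (sym G uv)
... | x , refl | y , refl =
  EdgeCover-TrLess (deleteEdge-EdgeCover H◁G x y) (edge⇒2≤Tr trG uv) (critical x y (EdgeCover.reflects H◁G uv))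

∪G-edgeless-vertexEdgeCritical : ∀ {n m r k} {G : Graph n} {H : Graph m} →
  G ≅G (H ∪G edgeless r) → (∀ x → ∃ (Adj H x)) → EdgeCritical G (suc (suc k)) → VertexEdgeCritical H (suc (suc k))
∪G-edgeless-vertexEdgeCritical {G = G} {H} G≅H∪ noIsolated (trG , critical) =
  (restrictPartition H◁G (proj₁ trG) , λ _ → ⊆G-partition≤ H⊆G trG)
  , ⊆G-vertexDeletionsLower H⊆G noIsolated critical
  , ⊆G-edgeDeletionsLower H⊆G critical
  where
  H⊆G : H ⊆G G
  H⊆G = ⊆G-trans ∪G-⊆G (≅G-⊆G G≅H∪)
  H◁G : EdgeCover H G
  H◁G = EdgeCover-trans ∪G-EdgeCover (≅G-EdgeCover G≅H∪)

Decomposition : (n k : ℕ) → Graph n → Set₁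
Decomposition n k G = Σ ℕ (λ nH → nH ≤ n × Σ (Graph nH) (λ H →
  VertexEdgeCritical H k × (G ≅G (H ∪G edgeless (n ∸ nH)))))

decomposition : ∀ {n m r k} {G : Graph n} {H : Graph m} →
  m + r ≡ n → VertexEdgeCritical H k → G ≅G (H ∪G edgeless r) → Decomposition n k G
decomposition {m = m} {r} {G = G} {H} refl critical G≅H∪ =
  m , m≤m+n m r , H , critical , subst (λ t → G ≅G (H ∪G edgeless t)) (≡-sym (m+n∸m≡n m r)) G≅H∪

core-decomposition : ∀ {n k} {G : Graph n} → EdgeCritical G (suc (suc k)) → Decomposition n (suc (suc k)) G
core-decomposition {G = G} (trG , critical) =
  decomposition m+r≡n (∪G-edgeless-vertexEdgeCritical G≅H∪ noIsolated (trG , critical)) G≅H∪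
  where
  open Core (proj₁ trG)
  open Split (split inCore?)
  open Inverse bij using (to; from; strictlyInverseʳ)
  H : Graph m
  H = induced G (from ∘ inj₁)
  G≅H∪ : G ≅G (H ∪G edgeless r)
  G≅H∪ = splitIsolated-≅G bij (λ b → outsideCore-isolated critical (right b))
  inCore-of-edge : ∀ {u z} → Adj G u z → ∃ λ c → from (inj₁ c) ≡ z
  inCore-of-edge {z = z} uz with to z | strictlyInverseʳ z
  ... | inj₁ c | refl = c , refl
  ... | inj₂ b | refl = contradiction (sym G uz) (outsideCore-isolated critical (right b) _)
  noIsolated : ∀ a → ∃ (Adj H a)
  noIsolated a with inCore-neighbour (left a)
  ... | z , az with inCore-of-edge az
  ... | c , refl = c , az

K₁-vertexEdgeCritical : VertexEdgeCritical (edgeless 1) 1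
K₁-vertexEdgeCritical =
  ( record { part = λ _ → zero ; nonempty = λ { zero → zero , refl } ; dominates = λ { zero zero () } }
  , λ _ → partition-size≤ )
  , (λ _ _ (P , _) → s≤s (partition-size≤ P))
  , λ _ _ ()

edgeCritical⇒decomposition : ∀ {n k} {G : Graph n} → EdgeCritical G k → Decomposition n k G
edgeCritical⇒decomposition {zero}  {zero}       (trG , _) =
  decomposition refl (trG , tt , λ ()) (edgeless-≅G (λ ()) (λ ()) ↔-refl)
edgeCritical⇒decomposition {suc _} {zero}       ((P , _) , _) = contradiction (TransitivePartition.part P zero) ¬Fin0
edgeCritical⇒decomposition {zero}  {suc zero}   ((P , _) , _) = contradiction (proj₁ (TransitivePartition.nonempty P zero)) ¬Fin0
edgeCritical⇒decomposition {suc _} {suc zero}   (trG , _) =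
  decomposition refl K₁-vertexEdgeCritical
    (edgeless-≅G (λ _ _ xy → 1+n≰n (edge⇒2≤Tr trG xy)) (∪G-edgeless-noEdge {1}) ↔-refl)
edgeCritical⇒decomposition {k = suc (suc _)} = core-decomposition

decomposition⇒edgeCritical : ∀ {n m r k} {G : Graph n} {H : Graph m} →
  IsTr G k → VertexEdgeCritical H k → G ≅G (H ∪G edgeless r) → EdgeCritical G k
decomposition⇒edgeCritical trG (_ , _ , critical) G≅H∪ =
  trG , EdgeCover-edgeDeletionsLower (EdgeCover-trans ∪G-EdgeCover (≅G-EdgeCover G≅H∪)) trG critical

theorem6 : (n k : ℕ) (G : Graph n) → IsTr G k →
    EdgeCritical G k ⇔
      Σ ℕ (λ nH → nH ≤ n × Σ (Graph nH) (λ H →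
        VertexEdgeCritical H k × (G ≅G (H ∪G edgeless (n ∸ nH)))))
theorem6 n k G trG =
  mk⇔ edgeCritical⇒decomposition
      λ (_ , _ , _ , critical , G≅H∪) → decomposition⇒edgeCritical trG critical G≅H∪
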